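{- Let $m$ and $s$ be positive integers and $a,d_1,d_2\in\mathbb{Z}/m\mathbb{Z}$. If the arithmetic triangle $\mathrm{AS}(a,(d_1,d_2),s)$ is balanced in $\mathbb{Z}/m\mathbb{Z}$, then $d_1$, $d_2$ and $d_2-d_1$ are all invertible in $\mathbb{Z}/m\mathbb{Z}$.
   Context: $\mathrm{AS}(a,(d_1,d_2),s)$ is the multiset $\{a+i_1d_1+i_2d_2: i_1,i_2\in\mathbb{N},\ i_1+i_2\le s-1\}$ of elements of $\mathbb{Z}/m\mathbb{Z}$. A multiset of $\mathbb{Z}/m\mathbb{Z}$ is balanced if every element of $\mathbb{Z}/m\mathbb{Z}$ occurs in it with the same multiplicity. -}

module Defs where

open import Data.Nat using (ℕ; zero; suc; _+_; _*_; _∸_; _≤ᵇ_; NonZero)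
open import Data.Nat.DivMod using (_mod_)
open import Data.Fin using (Fin; toℕ)
open import Data.Fin.Properties using (_≟_)
open import Data.Bool using (if_then_else_)
open import Data.List using (List; []; _∷_; upTo; concatMap; map; length; filter)
open import Data.Product using (_×_; _,_; ∃)
open import Relation.Binary.PropositionalEquality using (_≡_)
import Relation.Nullary

ZMod : ℕ → Set
ZMod m = Fin m

module _ {m : ℕ} .{{_ : NonZero m}} where

  infixl 6 _+ₘ_ _-ₘ_
  infixl 7 _*ₘ_

  _+ₘ_ : ZMod m → ZMod m → ZMod m
  x +ₘ y = (toℕ x + toℕ y) mod m

  _*ₘ_ : ZMod m → ZMod m → ZMod m
  x *ₘ y = (toℕ x * toℕ y) mod m

  _-ₘ_ : ZMod m → ZMod m → ZMod m
  x -ₘ y = (toℕ x + (m ∸ toℕ y)) mod m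

  _·ₘ_ : ℕ → ZMod m → ZMod m
  i ·ₘ x = (i * toℕ x) mod m

  oneₘ : ZMod m
  oneₘ = 1 mod m

  Invertible : ZMod m → Set
  Invertible x = ∃ λ y → x *ₘ y ≡ oneₘ

  triangleIndices : ℕ → List (ℕ × ℕ)
  triangleIndices s =
    concatMap (λ i₁ → map (λ i₂ → (i₁ , i₂)) (upTo (s ∸ i₁))) (upTo s)

  AS : ZMod m → ZMod m × ZMod m → ℕ → List (ZMod m)
  AS a (d₁ , d₂) s =
    map (λ { (i₁ , i₂) → a +ₘ (i₁ ·ₘ d₁) +ₘ (i₂ ·ₘ d₂) }) (triangleIndices s)

  multiplicity : ZMod m → List (ZMod m) → ℕ
  multiplicity x [] = 0
  multiplicity x (y ∷ ys) with x ≟ y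
  ... | Relation.Nullary.yes _ = suc (multiplicity x ys)
  ... | Relation.Nullary.no  _ = multiplicity x ys

  Balanced : List (ZMod m) → Set
  Balanced M = ∀ x y → multiplicity x M ≡ multiplicity y M

-- Let g divide m and d₁.  Modulo g the point (i₁ , i₂) of the triangle becomes a + i₂ d₂, and a
-- balanced multiset stays balanced modulo g.  If g ∤ d₂, the class of a receives the points with
-- g ∣ i₂ and the class of a + d₂ those with i₂ ≡ 1 (mod g); since the line i₂ = k carries s − k
-- points, the first class is strictly larger.  Hence g ∣ d₂, so every point lies in the class of
-- a, and balance forces g = 1.  The same argument along i₁ handles d₂, and along the third
-- barycentric coordinate i₃ = s − 1 − i₁ − i₂ it handles d₂ − d₁: when d₂ ≡ d₁ the point is
-- a + (s − 1) d₁ − i₃ d₁.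
module Submission where

open import Defs
open import Data.Nat using (ℕ; NonZero)
open import Data.Product using (_×_; _,_)

open import Data.Empty using (⊥-elim)
open import Data.Fin.Base using (Fin; toℕ; punchIn)
open import Data.Fin.Properties using (toℕ-fromℕ<; toℕ-injective; toℕ<n; punchInᵢ≢i)
import Data.Fin.Properties as Fin
open import Data.List.Base using (List; []; _∷_; _∷ʳ_; _++_; map; applyUpTo; upTo; concatMap)
open import Data.List.Properties using (applyUpTo-∷ʳ; map-upTo; map-++; map-∘)
open import Data.Nat.Base
open import Data.Nat.Coprimality using (Coprime; coprime-Bézout)
open import Data.Nat.Divisibility
open import Data.Nat.DivMod
open import Data.Nat.GCD using (module Bézout)
open import Data.Nat.ListAction using (sum)
open import Data.Nat.ListAction.Properties using (sum-++)
open import Data.Nat.Properties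
open import Data.Nat.Solver using (module +-*-Solver)
open import Data.Product using (∃)
open import Function.Base using (_∘_)
open import Relation.Binary.PropositionalEquality
open import Relation.Nullary using (Dec; yes; no; ¬_)

open import Algebra.Properties.CommutativeMonoid.Sum +-0-commutativeMonoid
  using (sum-remove; sum-cong-≗; sum-replicate-zero)
  renaming (sum to ∑ᶠ; ∑-distrib-+ to ∑ᶠ-distrib-+)
open import Algebra.Properties.CommutativeSemigroup +-commutativeSemigroup using (interchange)
open import Algebra.Properties.Semiring.Sum +-*-semiring using (*-distribʳ-sum)

infix 10 ∑<
∑< : ℕ → (ℕ → ℕ) → ℕ
∑< n f = sum (applyUpTo f n)
syntax ∑< n (λ k → e) = ∑[ k < n ] e

∑-cong : ∀ n {f h : ℕ → ℕ} → (∀ k → k < n → f k ≡ h k) → ∑< n f ≡ ∑< n h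
∑-cong zero    _  = refl
∑-cong (suc n) eq = cong₂ _+_ (eq 0 z<s) (∑-cong n λ k k<n → eq (suc k) (s<s k<n))

∑-mono-≤ : ∀ n {f h : ℕ → ℕ} → (∀ k → f k ≤ h k) → ∑< n f ≤ ∑< n h
∑-mono-≤ zero    _  = z≤n
∑-mono-≤ (suc n) le = +-mono-≤ (le 0) (∑-mono-≤ n (le ∘ suc))

∑-const : ∀ n c → ∑[ k < n ] c ≡ n * c
∑-const zero    c = refl
∑-const (suc n) c = cong (c +_) (∑-const n c)

∑-distrib-+ : ∀ n (f h : ℕ → ℕ) → ∑[ k < n ] (f k + h k) ≡ ∑< n f + ∑< n h
∑-distrib-+ zero    f h = refl
∑-distrib-+ (suc n) f h =
  trans (cong (f 0 + h 0 +_) (∑-distrib-+ n (f ∘ suc) (h ∘ suc))) (interchange (f 0) (h 0) _ _)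

∑-last : ∀ n f → ∑< (suc n) f ≡ ∑< n f + f n
∑-last n f = begin
  sum (applyUpTo f (suc n))   ≡⟨ cong sum (applyUpTo-∷ʳ f n) ⟨
  sum (applyUpTo f n ∷ʳ f n)  ≡⟨ sum-++ (applyUpTo f n) _ ⟩
  ∑< n f + (f n + 0)          ≡⟨ cong (∑< n f +_) (+-identityʳ (f n)) ⟩
  ∑< n f + f n                ∎
  where open ≡-Reasoning

∑-reverse : ∀ n f → ∑[ k < n ] f (n ∸ suc k) ≡ ∑< n f
∑-reverse zero    f = refl
∑-reverse (suc n) f = begin
  f n + ∑[ k < n ] f (n ∸ suc k)  ≡⟨ cong (f n +_) (∑-reverse n f) ⟩
  f n + ∑< n f                    ≡⟨ +-comm (f n) _ ⟩
  ∑< n f + f n                    ≡⟨ ∑-last n f ⟨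
  ∑< (suc n) f                    ∎
  where open ≡-Reasoning

∑-split : ∀ a b f → ∑< (a + b) f ≡ ∑< a f + ∑[ k < b ] f (a + k)
∑-split zero    b f = refl
∑-split (suc a) b f = trans (cong (f 0 +_) (∑-split a b (f ∘ suc))) (sym (+-assoc (f 0) _ _))

∑-periodic : ∀ g f → (∀ k → f (g + k) ≡ f k) → ∀ q → ∑< (q * g) f ≡ q * ∑< g f
∑-periodic g f per zero    = refl
∑-periodic g f per (suc q) = begin
  ∑< (g + q * g) f                   ≡⟨ ∑-split g (q * g) f ⟩
  ∑< g f + ∑[ k < q * g ] f (g + k)  ≡⟨ cong (∑< g f +_) (∑-cong (q * g) λ k _ → per k) ⟩
  ∑< g f + ∑< (q * g) f              ≡⟨ cong (∑< g f +_) (∑-periodic g f per q) ⟩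
  ∑< g f + q * ∑< g f                ∎
  where open ≡-Reasoning

-- Sums over the triangle {(i , j) ∣ i + j < s}

rampSum : ℕ → (ℕ → ℕ) → ℕ
rampSum s f = ∑[ k < s ] ((s ∸ k) * f k)

rampSum-suc : ∀ s f → rampSum (suc s) f ≡ ∑< (suc s) f + rampSum s f
rampSum-suc s f = begin
  ∑[ k < suc s ] ((suc s ∸ k) * f k)         ≡⟨ ∑-cong (suc s) (λ k k≤s → cong (_* f k) (+-∸-assoc 1 (s≤s⁻¹ k≤s))) ⟩
  ∑[ k < suc s ] (f k + (s ∸ k) * f k)       ≡⟨ ∑-distrib-+ (suc s) f (λ k → (s ∸ k) * f k) ⟩
  ∑< (suc s) f + ∑[ k < suc s ] ((s ∸ k) * f k)
                                             ≡⟨ cong (∑< (suc s) f +_) (∑-last s (λ k → (s ∸ k) * f k)) ⟩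
  ∑< (suc s) f + (rampSum s f + (s ∸ s) * f s)
                                             ≡⟨ cong (λ z → ∑< (suc s) f + (rampSum s f + z * f s)) (n∸n≡0 s) ⟩
  ∑< (suc s) f + (rampSum s f + 0)           ≡⟨ cong (∑< (suc s) f +_) (+-identityʳ _) ⟩
  ∑< (suc s) f + rampSum s f                 ∎
  where open ≡-Reasoning

record ShiftedBelow (f₁ f₀ : ℕ → ℕ) : Set where
  field
    head-positive : 1 ≤ f₀ 0
    head-zero     : f₁ 0 ≡ 0
    tail-≤        : ∀ j → f₁ (suc j) ≤ f₀ j

rampSum-< : ∀ s {f₀ f₁} → ShiftedBelow f₁ f₀ → rampSum (suc s) f₁ < rampSum (suc s) f₀
rampSum-< s {f₀} {f₁} below = begin-strict
  rampSum (suc s) f₁                ≡⟨ cong (λ z → suc s * z + rampSum s (f₁ ∘ suc)) head-zero ⟩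
  suc s * 0 + rampSum s (f₁ ∘ suc)  ≡⟨ cong (_+ rampSum s (f₁ ∘ suc)) (*-zeroʳ s) ⟩
  rampSum s (f₁ ∘ suc)              ≤⟨ ∑-mono-≤ s (λ k → *-monoʳ-≤ (s ∸ k) (tail-≤ k)) ⟩
  rampSum s f₀                      <⟨ +-monoˡ-< (rampSum s f₀) (≤-trans head-positive (m≤m+n (f₀ 0) _)) ⟩
  ∑< (suc s) f₀ + rampSum s f₀      ≡⟨ rampSum-suc s f₀ ⟨
  rampSum (suc s) f₀                ∎
  where open ≤-Reasoning; open ShiftedBelow below

triangleSum : ℕ → (ℕ → ℕ → ℕ) → ℕ
triangleSum s w = ∑[ i < s ] ∑[ j < s ∸ i ] w i j

triangleSum-cong : ∀ s {w w′ : ℕ → ℕ → ℕ} → (∀ i j → i < s → j < s ∸ i → w i j ≡ w′ i j) →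
                   triangleSum s w ≡ triangleSum s w′
triangleSum-cong s eq = ∑-cong s λ i i<s → ∑-cong (s ∸ i) λ j → eq i j i<s

-- The level sets of c on the triangle have the sizes s, s ∸ 1, …, 1 of those of a barycentric
-- coordinate.
Barycentric : ℕ → (ℕ → ℕ → ℕ) → Set
Barycentric s c = ∀ f → triangleSum s (λ i j → f (c i j)) ≡ rampSum s f

first-barycentric : ∀ s → Barycentric s (λ i _ → i)
first-barycentric s f = ∑-cong s λ i _ → ∑-const (s ∸ i) (f i)

second-barycentric : ∀ s → Barycentric s (λ _ j → j)
second-barycentric zero    f = refl
second-barycentric (suc s) f = begin
  ∑< (suc s) f + triangleSum s (λ _ j → f j)  ≡⟨ cong (∑< (suc s) f +_) (second-barycentric s f) ⟩
  ∑< (suc s) f + rampSum s f                  ≡⟨ rampSum-suc s f ⟨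
  rampSum (suc s) f                           ∎
  where open ≡-Reasoning

third-barycentric : ∀ s → Barycentric s (λ i j → s ∸ i ∸ suc j)
third-barycentric s f = trans (∑-cong s λ i _ → ∑-reverse (s ∸ i) f) (second-barycentric s f)

barycentric-sum : ∀ s i j → i < suc s → j < suc s ∸ i → i + j + (suc s ∸ i ∸ suc j) ≡ s
barycentric-sum s i j i<1+s j<1+s-i = suc-injective (begin
  suc (i + j + k)    ≡⟨ cong suc (+-assoc i j k) ⟩
  suc (i + (j + k))  ≡⟨ +-suc i (j + k) ⟨
  i + (suc j + k)    ≡⟨ cong (i +_) (m+[n∸m]≡n j<1+s-i) ⟩
  i + (suc s ∸ i)    ≡⟨ m+[n∸m]≡n (<⇒≤ i<1+s) ⟩
  suc s              ∎)
  where
  open ≡-Reasoning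
  k : ℕ
  k = suc s ∸ i ∸ suc j

𝟙 : {P : Set} → Dec P → ℕ
𝟙 (yes _) = 1
𝟙 (no _)  = 0

𝟙-yes : {P : Set} (p? : Dec P) → P → 𝟙 p? ≡ 1
𝟙-yes (yes _) _ = refl
𝟙-yes (no ¬p) p = ⊥-elim (¬p p)

𝟙-no : {P : Set} (p? : Dec P) → ¬ P → 𝟙 p? ≡ 0
𝟙-no (yes p) ¬p = ⊥-elim (¬p p)
𝟙-no (no _)  _  = refl

𝟙-cong : {P Q : Set} (p? : Dec P) (q? : Dec Q) → (P → Q) → (Q → P) → 𝟙 p? ≡ 𝟙 q?
𝟙-cong (yes _) (yes _) _   _   = refl
𝟙-cong (yes p) (no ¬q) p→q _   = ⊥-elim (¬q (p→q p))
𝟙-cong (no ¬p) (yes q) _   q→p = ⊥-elim (¬p (q→p q))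
𝟙-cong (no _)  (no _)  _   _   = refl

𝟙≤1 : {P : Set} (p? : Dec P) → 𝟙 p? ≤ 1
𝟙≤1 (yes _) = ≤-refl
𝟙≤1 (no _)  = z≤n

infix 4 _≡_modulo_ _≟_modulo_

_≡_modulo_ : ℕ → ℕ → (g : ℕ) .{{_ : NonZero g}} → Set
x ≡ y modulo g = x % g ≡ y % g

_≟_modulo_ : ∀ x y g .{{_ : NonZero g}} → Dec (x ≡ y modulo g)
x ≟ y modulo g = x % g ≟ y % g

module _ {g : ℕ} .{{_ : NonZero g}} where

  +-cong-mod : ∀ {x x′ y y′} → x ≡ x′ modulo g → y ≡ y′ modulo g → x + y ≡ x′ + y′ modulo g
  +-cong-mod {x} {x′} {y} {y′} x≡x′ y≡y′ = begin
    (x + y) % g              ≡⟨ %-distribˡ-+ x y g ⟩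
    (x % g + y % g) % g      ≡⟨ cong₂ (λ u v → (u + v) % g) x≡x′ y≡y′ ⟩
    (x′ % g + y′ % g) % g    ≡⟨ %-distribˡ-+ x′ y′ g ⟨
    (x′ + y′) % g            ∎
    where open ≡-Reasoning

  *-cong-mod : ∀ {x x′ y y′} → x ≡ x′ modulo g → y ≡ y′ modulo g → x * y ≡ x′ * y′ modulo g
  *-cong-mod {x} {x′} {y} {y′} x≡x′ y≡y′ = begin
    (x * y) % g              ≡⟨ %-distribˡ-* x y g ⟩
    (x % g * (y % g)) % g    ≡⟨ cong₂ (λ u v → (u * v) % g) x≡x′ y≡y′ ⟩
    (x′ % g * (y′ % g)) % g  ≡⟨ %-distribˡ-* x′ y′ g ⟨
    (x′ * y′) % g            ∎
    where open ≡-Reasoning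

  ≡0-mod⇒∣ : ∀ {x} → x ≡ 0 modulo g → g ∣ x
  ≡0-mod⇒∣ {x} x≡0 = m%n≡0⇒n∣m x g (trans x≡0 (n∣m⇒m%n≡0 0 g (g ∣0)))

  ∣⇒≡0-mod : ∀ {x} → g ∣ x → x ≡ 0 modulo g
  ∣⇒≡0-mod {x} g∣x = trans (n∣m⇒m%n≡0 x g g∣x) (sym (n∣m⇒m%n≡0 0 g (g ∣0)))

  ∣[g∸1]*x+x : ∀ x → g ∣ (g ∸ 1) * x + x
  ∣[g∸1]*x+x x = divides x (begin
    (g ∸ 1) * x + x      ≡⟨ cong ((g ∸ 1) * x +_) (*-identityˡ x) ⟨
    (g ∸ 1) * x + 1 * x  ≡⟨ *-distribʳ-+ x (g ∸ 1) 1 ⟨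
    (g ∸ 1 + 1) * x      ≡⟨ cong (_* x) (m∸n+n≡m (>-nonZero⁻¹ g)) ⟩
    g * x                ≡⟨ *-comm g x ⟩
    x * g                ∎)
    where open ≡-Reasoning

  +-cancelˡ-mod : ∀ x {y z} → x + y ≡ x + z modulo g → y ≡ z modulo g
  +-cancelˡ-mod x {y} {z} x+y≡x+z =
    trans (sym (cancel y)) (trans (+-cong-mod {x = (g ∸ 1) * x} refl x+y≡x+z) (cancel z))
    where
    cancel : ∀ y → (g ∸ 1) * x + (x + y) ≡ y modulo g
    cancel y = trans (%-congˡ (sym (+-assoc ((g ∸ 1) * x) x y))) (%-remove-+ˡ y (∣[g∸1]*x+x x))

  𝟙-resp-mod : ∀ {x x′} t → x ≡ x′ modulo g → 𝟙 (x ≟ t modulo g) ≡ 𝟙 (x′ ≟ t modulo g)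
  𝟙-resp-mod t x≡x′ = 𝟙-cong _ _ (trans (sym x≡x′)) (trans x≡x′)

  𝟙-shift : ∀ {v X u} t → v ≡ X + u modulo g → 𝟙 (v ≟ X + t modulo g) ≡ 𝟙 (u ≟ t modulo g)
  𝟙-shift {X = X} t v≡X+u = 𝟙-cong _ _
    (λ v≡X+t → +-cancelˡ-mod X (trans (sym v≡X+u) v≡X+t))
    (λ u≡t → trans v≡X+u (+-cong-mod refl u≡t))

  shiftedBelow-step : ∀ {D} → ¬ g ∣ D →
                      ShiftedBelow (λ k → 𝟙 (k * D ≟ D modulo g)) (λ k → 𝟙 (k * D ≟ 0 modulo g))
  shiftedBelow-step {D} g∤D = record
    { head-positive = ≤-reflexive (sym (𝟙-yes _ refl))
    ; head-zero     = 𝟙-no _ (λ 0≡D → g∤D (≡0-mod⇒∣ (sym 0≡D)))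
    ; tail-≤        = λ j → ≤-reflexive (𝟙-cong _ _
        (λ D+jD≡D → +-cancelˡ-mod D (trans D+jD≡D (%-congˡ (sym (+-identityʳ D)))))
        (λ jD≡0 → trans (+-cong-mod {x = D} refl jD≡0) (%-congˡ (+-identityʳ D))))
    }

  shiftedBelow-zero : ¬ g ∣ 1 →
                      ShiftedBelow (λ k → 𝟙 (k * 0 ≟ 1 modulo g)) (λ k → 𝟙 (k * 0 ≟ 0 modulo g))
  shiftedBelow-zero g∤1 = record
    { head-positive = ≤-reflexive (sym (𝟙-yes _ refl))
    ; head-zero     = 𝟙-no _ (λ 0≡1 → g∤1 (≡0-mod⇒∣ (sym 0≡1)))
    ; tail-≤        = λ j → ≤-trans (𝟙≤1 _) (≤-reflexive (sym (𝟙-yes _ (%-congˡ (*-zeroʳ j)))))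
    }

nonZero-divisor : ∀ {g m} .{{_ : NonZero m}} → g ∣ m → NonZero g
nonZero-divisor {m = m} g∣m = ≢-nonZero λ { refl → ≢-nonZero⁻¹ m (0∣⇒≡0 g∣m) }

-- Counting residue classes

∑ᶠ-toℕ : ∀ n (h : ℕ → ℕ) → ∑ᶠ {n} (h ∘ toℕ) ≡ ∑< n h
∑ᶠ-toℕ zero    h = refl
∑ᶠ-toℕ (suc n) h = cong (h 0 +_) (∑ᶠ-toℕ n (h ∘ suc))

∑ᶠ-δ : ∀ {n} (w : Fin n → ℕ) y → ∑ᶠ {n} (λ x → w x * 𝟙 (x Fin.≟ y)) ≡ w y
∑ᶠ-δ {suc n} w y = begin
  ∑ᶠ δw                       ≡⟨ sum-remove {i = y} δw ⟩
  δw y + ∑ᶠ (δw ∘ punchIn y)  ≡⟨ cong₂ _+_ diagonal (trans (sum-cong-≗ off-diagonal) (sum-replicate-zero n)) ⟩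
  w y + 0                     ≡⟨ +-identityʳ (w y) ⟩
  w y                         ∎
  where
  open ≡-Reasoning
  δw : Fin (suc n) → ℕ
  δw x = w x * 𝟙 (x Fin.≟ y)
  diagonal : δw y ≡ w y
  diagonal = trans (cong (w y *_) (𝟙-yes (y Fin.≟ y) refl)) (*-identityʳ (w y))
  off-diagonal : ∀ j → δw (punchIn y j) ≡ 0
  off-diagonal j = trans (cong (w (punchIn y j) *_) (𝟙-no _ (punchInᵢ≢i y j))) (*-zeroʳ (w (punchIn y j)))

∑-residueClass : ∀ g .{{_ : NonZero g}} t q → ∑[ k < q * g ] 𝟙 (k ≟ t modulo g) ≡ q
∑-residueClass g t q = begin
  ∑[ k < q * g ] 𝟙 (k ≟ t modulo g)  ≡⟨ ∑-periodic g _ (λ k → 𝟙-resp-mod t (%-remove-+ˡ k ∣-refl)) q ⟩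
  q * ∑[ k < g ] 𝟙 (k ≟ t modulo g)  ≡⟨ cong (q *_) one-period ⟩
  q * 1                              ≡⟨ *-identityʳ q ⟩
  q                                  ∎
  where
  open ≡-Reasoning
  toℕ≡⇒≡mod : ∀ (x : Fin g) → toℕ x ≡ t modulo g → x ≡ t mod g
  toℕ≡⇒≡mod x x≡t = toℕ-injective (begin
    toℕ x          ≡⟨ m<n⇒m%n≡m (toℕ<n x) ⟨
    toℕ x % g      ≡⟨ x≡t ⟩
    t % g          ≡⟨ toℕ-fromℕ< _ ⟨
    toℕ (t mod g)  ∎)
  ≡mod⇒toℕ≡ : ∀ (x : Fin g) → x ≡ t mod g → toℕ x ≡ t modulo g
  ≡mod⇒toℕ≡ _ refl = trans (%-congˡ (toℕ-fromℕ< _)) (m%n%n≡m%n t g)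
  one-period : ∑[ k < g ] 𝟙 (k ≟ t modulo g) ≡ 1
  one-period = begin
    ∑[ k < g ] 𝟙 (k ≟ t modulo g)           ≡⟨ ∑ᶠ-toℕ g _ ⟨
    ∑ᶠ {g} (λ x → 𝟙 (toℕ x ≟ t modulo g))   ≡⟨ sum-cong-≗ (λ x → 𝟙-cong _ _ (toℕ≡⇒≡mod x) (≡mod⇒toℕ≡ x)) ⟩
    ∑ᶠ {g} (λ x → 𝟙 (x Fin.≟ t mod g))      ≡⟨ sum-cong-≗ (λ x → *-identityˡ (𝟙 (x Fin.≟ t mod g))) ⟨
    ∑ᶠ {g} (λ x → 1 * 𝟙 (x Fin.≟ t mod g))  ≡⟨ ∑ᶠ-δ (λ _ → 1) (t mod g) ⟩
    1                                       ∎

sum-map-concatMap : ∀ {A B : Set} (w : B → ℕ) (G : A → List B) xs →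
                    sum (map w (concatMap G xs)) ≡ sum (map (λ x → sum (map w (G x))) xs)
sum-map-concatMap w G []       = refl
sum-map-concatMap w G (x ∷ xs) = begin
  sum (map w (G x ++ concatMap G xs))               ≡⟨ cong sum (map-++ w (G x) _) ⟩
  sum (map w (G x) ++ map w (concatMap G xs))       ≡⟨ sum-++ (map w (G x)) _ ⟩
  sum (map w (G x)) + sum (map w (concatMap G xs))  ≡⟨ cong (sum (map w (G x)) +_) (sum-map-concatMap w G xs) ⟩
  sum (map w (G x)) + sum (map (λ x → sum (map w (G x))) xs)
                                                    ∎
  where open ≡-Reasoning

sum-map-upTo : ∀ (f : ℕ → ℕ) n → sum (map f (upTo n)) ≡ ∑< n f
sum-map-upTo f n = cong sum (map-upTo f n)

module _ {m : ℕ} .{{_ : NonZero m}} where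

  multiplicity-∷ : ∀ (x y : ZMod m) ys → multiplicity x (y ∷ ys) ≡ 𝟙 (x Fin.≟ y) + multiplicity x ys
  multiplicity-∷ x y ys with x Fin.≟ y
  ... | yes _ = refl
  ... | no  _ = refl

  sum-map≡∑ᶠ-multiplicity : ∀ (w : ZMod m → ℕ) xs → sum (map w xs) ≡ ∑ᶠ {m} (λ x → w x * multiplicity x xs)
  sum-map≡∑ᶠ-multiplicity w []       = sym (trans (sum-cong-≗ (*-zeroʳ ∘ w)) (sum-replicate-zero m))
  sum-map≡∑ᶠ-multiplicity w (y ∷ ys) = begin
    w y + sum (map w ys)
      ≡⟨ cong₂ _+_ (sym (∑ᶠ-δ w y)) (sum-map≡∑ᶠ-multiplicity w ys) ⟩
    ∑ᶠ {m} (λ x → w x * 𝟙 (x Fin.≟ y)) + ∑ᶠ {m} (λ x → w x * multiplicity x ys)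
      ≡⟨ ∑ᶠ-distrib-+ (λ x → w x * 𝟙 (x Fin.≟ y)) (λ x → w x * multiplicity x ys) ⟨
    ∑ᶠ {m} (λ x → w x * 𝟙 (x Fin.≟ y) + w x * multiplicity x ys)
      ≡⟨ sum-cong-≗ (λ x → *-distribˡ-+ (w x) _ _) ⟨
    ∑ᶠ {m} (λ x → w x * (𝟙 (x Fin.≟ y) + multiplicity x ys))
      ≡⟨ sum-cong-≗ (λ x → cong (w x *_) (multiplicity-∷ x y ys)) ⟨
    ∑ᶠ {m} (λ x → w x * multiplicity x (y ∷ ys))
      ∎
    where open ≡-Reasoning

  classCount : (g : ℕ) .{{_ : NonZero g}} → ℕ → List (ZMod m) → ℕ
  classCount g t xs = sum (map (λ x → 𝟙 (toℕ x ≟ t modulo g)) xs)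

  balanced⇒classCount : ∀ {g} .{{_ : NonZero g}} (g∣m : g ∣ m) {xs : List (ZMod m)} → Balanced xs →
                        ∀ x₀ t → classCount g t xs ≡ quotient g∣m * multiplicity x₀ xs
  balanced⇒classCount {g} g∣m {xs} bal x₀ t = begin
    classCount g t xs
      ≡⟨ sum-map≡∑ᶠ-multiplicity _ xs ⟩
    ∑ᶠ {m} (λ x → 𝟙 (toℕ x ≟ t modulo g) * multiplicity x xs)
      ≡⟨ sum-cong-≗ (λ x → cong (𝟙 (toℕ x ≟ t modulo g) *_) (bal x x₀)) ⟩
    ∑ᶠ {m} (λ x → 𝟙 (toℕ x ≟ t modulo g) * μ)
      ≡⟨ *-distribʳ-sum {m} μ (λ x → 𝟙 (toℕ x ≟ t modulo g)) ⟨
    ∑ᶠ {m} (λ x → 𝟙 (toℕ x ≟ t modulo g)) * μ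
      ≡⟨ cong (_* μ) (∑ᶠ-toℕ m _) ⟩
    ∑[ k < m ] 𝟙 (k ≟ t modulo g) * μ
      ≡⟨ cong (λ n → ∑[ k < n ] 𝟙 (k ≟ t modulo g) * μ) (m∣n⇒n≡quotient*m g∣m) ⟩
    ∑[ k < quotient g∣m * g ] 𝟙 (k ≟ t modulo g) * μ
      ≡⟨ cong (_* μ) (∑-residueClass g t (quotient g∣m)) ⟩
    quotient g∣m * μ
      ∎
    where
    open ≡-Reasoning
    μ : ℕ
    μ = multiplicity x₀ xs

  toℕ-mod : ∀ {g} .{{_ : NonZero g}} → g ∣ m → ∀ n → toℕ (n mod m) ≡ n modulo g
  toℕ-mod {g} g∣m n = trans (%-congˡ (toℕ-fromℕ< _)) (m∣n⇒o%n%m≡o%m g m n g∣m)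

  ∣toℕ-ₘ⇒≡ : ∀ {g} .{{_ : NonZero g}} → g ∣ m → ∀ {x y : ZMod m} → g ∣ toℕ (x -ₘ y) →
             toℕ x ≡ toℕ y modulo g
  ∣toℕ-ₘ⇒≡ {g} g∣m {x} {y} g∣x-y = begin
    toℕ x % g                          ≡⟨ %-remove-+ʳ (toℕ x) g∣m ⟨
    (toℕ x + m) % g                    ≡⟨ %-congˡ (cong (toℕ x +_) (m∸n+n≡m (<⇒≤ (toℕ<n y)))) ⟨
    (toℕ x + (m ∸ toℕ y + toℕ y)) % g  ≡⟨ %-congˡ (+-assoc (toℕ x) _ (toℕ y)) ⟨
    (toℕ x + (m ∸ toℕ y) + toℕ y) % g  ≡⟨ +-cong-mod (trans (sym (toℕ-mod g∣m _)) (∣⇒≡0-mod g∣x-y)) refl ⟩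
    (0 + toℕ y) % g                    ∎
    where open ≡-Reasoning

  sum-map-AS : ∀ (w : ZMod m → ℕ) a d₁ d₂ s →
               sum (map w (AS a (d₁ , d₂) s)) ≡ triangleSum s (λ i j → w (a +ₘ i ·ₘ d₁ +ₘ j ·ₘ d₂))
  sum-map-AS w a d₁ d₂ s = begin
    sum (map w (AS a (d₁ , d₂) s))                        ≡⟨ cong sum (map-∘ (triangleIndices {m} s)) ⟨
    sum (map (w ∘ E) (triangleIndices {m} s))             ≡⟨ sum-map-concatMap (w ∘ E) _ (upTo s) ⟩
    sum (map (λ i → sum (map (w ∘ E) (row i))) (upTo s))  ≡⟨ sum-map-upTo _ s ⟩
    ∑[ i < s ] sum (map (w ∘ E) (row i))                  ≡⟨ ∑-cong s (λ i _ → sum-row i) ⟩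
    triangleSum s (λ i j → w (E (i , j)))                 ∎
    where
    open ≡-Reasoning
    E : ℕ × ℕ → ZMod m
    E (i , j) = a +ₘ i ·ₘ d₁ +ₘ j ·ₘ d₂
    row : ℕ → List (ℕ × ℕ)
    row i = map (i ,_) (upTo (s ∸ i))
    sum-row : ∀ i → sum (map (w ∘ E) (row i)) ≡ ∑[ j < s ∸ i ] w (E (i , j))
    sum-row i = trans (cong sum (sym (map-∘ (upTo (s ∸ i))))) (sum-map-upTo _ (s ∸ i))

-- Balanced arithmetic triangles

module Triangle {m : ℕ} .{{_ : NonZero m}} (a d₁ d₂ : ZMod m) where

  A D₁ D₂ : ℕ
  A  = toℕ a
  D₁ = toℕ d₁
  D₂ = toℕ d₂

  value : ℕ → ℕ → ℕ
  value i j = A + i * D₁ + j * D₂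

  module _ {g : ℕ} .{{_ : NonZero g}} (g∣m : g ∣ m) where

    classCount-AS : ∀ s t →
                    classCount g t (AS a (d₁ , d₂) s) ≡ triangleSum s (λ i j → 𝟙 (value i j ≟ t modulo g))
    classCount-AS s t =
      trans (sum-map-AS _ a d₁ d₂ s) (triangleSum-cong s λ i j _ _ → 𝟙-resp-mod t (toℕ-element i j))
      where
      toℕ-element : ∀ i j → toℕ (a +ₘ i ·ₘ d₁ +ₘ j ·ₘ d₂) ≡ value i j modulo g
      toℕ-element i j = trans (toℕ-mod g∣m _)
        (+-cong-mod (trans (toℕ-mod g∣m _) (+-cong-mod refl (toℕ-mod g∣m _))) (toℕ-mod g∣m _))

    classCount-along : ∀ {s c X D} → Barycentric s c →
                       (∀ i j → i < s → j < s ∸ i → value i j ≡ X + c i j * D modulo g) →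
                       ∀ t → classCount g (X + t) (AS a (d₁ , d₂) s) ≡ rampSum s (λ k → 𝟙 (k * D ≟ t modulo g))
    classCount-along {s} {c} {X} {D} bary value≡ t = begin
      classCount g (X + t) (AS a (d₁ , d₂) s)
        ≡⟨ classCount-AS s _ ⟩
      triangleSum s (λ i j → 𝟙 (value i j ≟ X + t modulo g))
        ≡⟨ triangleSum-cong s (λ i j i<s j<s-i → 𝟙-shift t (value≡ i j i<s j<s-i)) ⟩
      triangleSum s (λ i j → 𝟙 (c i j * D ≟ t modulo g))
        ≡⟨ bary _ ⟩
      rampSum s (λ k → 𝟙 (k * D ≟ t modulo g))
        ∎
      where open ≡-Reasoning

    value≡-dropFirst : g ∣ D₁ → ∀ i j → value i j ≡ A + j * D₂ modulo g
    value≡-dropFirst g∣D₁ i j = +-cong-mod (%-remove-+ʳ A (∣n⇒∣m*n i g∣D₁)) refl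

    value≡-dropSecond : g ∣ D₂ → ∀ i j → value i j ≡ A + i * D₁ modulo g
    value≡-dropSecond g∣D₂ i j = %-remove-+ʳ _ (∣n⇒∣m*n j g∣D₂)

    value≡-constant : g ∣ D₁ → g ∣ D₂ → ∀ i j → value i j ≡ A modulo g
    value≡-constant g∣D₁ g∣D₂ i j = trans (value≡-dropFirst g∣D₁ i j) (%-remove-+ʳ A (∣n⇒∣m*n j g∣D₂))

    -- As i + j + k = s, the point is A + s D₁ − k D₁, and (g ∸ 1) D₁ represents − D₁ modulo g.
    value≡-third : ∀ s → D₂ ≡ D₁ modulo g → ∀ i j → i < suc s → j < suc s ∸ i →
                   value i j ≡ A + s * D₁ + (suc s ∸ i ∸ suc j) * ((g ∸ 1) * D₁) modulo g
    value≡-third s D₂≡D₁ i j i<1+s j<1+s-i = begin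
      (A + i * D₁ + j * D₂) % g
        ≡⟨ +-cong-mod {x = A + i * D₁} refl (*-cong-mod {x = j} refl D₂≡D₁) ⟩
      (A + i * D₁ + j * D₁) % g
        ≡⟨ %-remove-+ʳ _ (n∣m*n (k * D₁)) ⟨
      (A + i * D₁ + j * D₁ + k * D₁ * g) % g
        ≡⟨ %-congˡ regroup ⟨
      (A + (i + j + k) * D₁ + k * ((g ∸ 1) * D₁)) % g
        ≡⟨ %-congˡ (cong (λ n → A + n * D₁ + k * ((g ∸ 1) * D₁)) (barycentric-sum s i j i<1+s j<1+s-i)) ⟩
      (A + s * D₁ + k * ((g ∸ 1) * D₁)) % g
        ∎
      where
      open ≡-Reasoning
      k : ℕ
      k = suc s ∸ i ∸ suc j
      regroup : A + (i + j + k) * D₁ + k * ((g ∸ 1) * D₁) ≡ A + i * D₁ + j * D₁ + k * D₁ * g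
      regroup = trans
        (solve 6 (λ A i j k D n → A :+ (i :+ j :+ k) :* D :+ k :* (n :* D)
                               := A :+ i :* D :+ j :* D :+ k :* D :* (con 1 :+ n))
                 refl A i j k D₁ (g ∸ 1))
        (cong (λ n → A + i * D₁ + j * D₁ + k * D₁ * n) (suc-pred g))
        where open +-*-Solver

    module _ {s : ℕ} (bal : Balanced (AS a (d₁ , d₂) (suc s))) where

      balanced⇒¬shiftedBelow : ∀ {c X D} → Barycentric (suc s) c →
        (∀ i j → i < suc s → j < suc s ∸ i → value i j ≡ X + c i j * D modulo g) →
        ∀ E → ¬ ShiftedBelow (λ k → 𝟙 (k * D ≟ E modulo g)) (λ k → 𝟙 (k * D ≟ 0 modulo g))
      balanced⇒¬shiftedBelow {c} {X} {D} bary value≡ E below = <-irrefl same-rampSum (rampSum-< s below)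
        where
        open ≡-Reasoning
        L : List (ZMod m)
        L = AS a (d₁ , d₂) (suc s)
        same-rampSum : rampSum (suc s) (λ k → 𝟙 (k * D ≟ E modulo g)) ≡ rampSum (suc s) (λ k → 𝟙 (k * D ≟ 0 modulo g))
        same-rampSum = begin
          rampSum (suc s) (λ k → 𝟙 (k * D ≟ E modulo g))  ≡⟨ classCount-along {suc s} {c} bary value≡ E ⟨
          classCount g (X + E) L                           ≡⟨ balanced⇒classCount g∣m bal a _ ⟩
          quotient g∣m * multiplicity a L                  ≡⟨ balanced⇒classCount g∣m bal a _ ⟨
          classCount g (X + 0) L                           ≡⟨ classCount-along {suc s} {c} bary value≡ 0 ⟩
          rampSum (suc s) (λ k → 𝟙 (k * D ≟ 0 modulo g))  ∎

      balanced⇒∣step : ∀ {c X D} → Barycentric (suc s) c →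
                       (∀ i j → i < suc s → j < suc s ∸ i → value i j ≡ X + c i j * D modulo g) → g ∣ D
      balanced⇒∣step {c} {X} {D} bary value≡ with g ∣? D
      ... | yes g∣D = g∣D
      ... | no  g∤D = ⊥-elim (balanced⇒¬shiftedBelow {c} {X} bary value≡ D (shiftedBelow-step g∤D))

      -- All points lie in the class of A: compare it with the class of A + 1 as a step D = 0.
      balanced⇒common-divisor≡1 : g ∣ D₁ → g ∣ D₂ → g ≡ 1
      balanced⇒common-divisor≡1 g∣D₁ g∣D₂ with g ∣? 1
      ... | yes g∣1 = ∣1⇒≡1 g∣1
      ... | no  g∤1 = ⊥-elim (balanced⇒¬shiftedBelow {λ i _ → i} {A}
                                (first-barycentric (suc s)) value≡A+i*0 1 (shiftedBelow-zero g∤1))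
        where
        value≡A+i*0 : ∀ i j → i < suc s → j < suc s ∸ i → value i j ≡ A + i * 0 modulo g
        value≡A+i*0 i j _ _ =
          trans (value≡-constant g∣D₁ g∣D₂ i j) (%-congˡ (sym (trans (cong (A +_) (*-zeroʳ i)) (+-identityʳ A))))

  module _ {s : ℕ} (bal : Balanced (AS a (d₁ , d₂) (suc s))) where

    d₁-coprime : Coprime D₁ m
    d₁-coprime {g} (g∣D₁ , g∣m) = balanced⇒common-divisor≡1 g∣m {s} bal g∣D₁ g∣D₂
      where
      instance
        g≢0 : NonZero g
        g≢0 = nonZero-divisor g∣m
      g∣D₂ : g ∣ D₂
      g∣D₂ = balanced⇒∣step g∣m {s} bal {λ _ j → j} {A} (second-barycentric (suc s))
                             (λ i j _ _ → value≡-dropFirst g∣m g∣D₁ i j)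

    d₂-coprime : Coprime D₂ m
    d₂-coprime {g} (g∣D₂ , g∣m) = balanced⇒common-divisor≡1 g∣m {s} bal g∣D₁ g∣D₂
      where
      instance
        g≢0 : NonZero g
        g≢0 = nonZero-divisor g∣m
      g∣D₁ : g ∣ D₁
      g∣D₁ = balanced⇒∣step g∣m {s} bal {λ i _ → i} {A} (first-barycentric (suc s))
                             (λ i j _ _ → value≡-dropSecond g∣m g∣D₂ i j)

    d₂-d₁-coprime : Coprime (toℕ (d₂ -ₘ d₁)) m
    d₂-d₁-coprime {g} (g∣D₂-D₁ , g∣m) = balanced⇒common-divisor≡1 g∣m {s} bal g∣D₁ g∣D₂
      where
      instance
        g≢0 : NonZero g
        g≢0 = nonZero-divisor g∣m
      D₂≡D₁ : D₂ ≡ D₁ modulo g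
      D₂≡D₁ = ∣toℕ-ₘ⇒≡ g∣m g∣D₂-D₁
      g∣[g∸1]*D₁ : g ∣ (g ∸ 1) * D₁
      g∣[g∸1]*D₁ = balanced⇒∣step g∣m {s} bal {λ i j → suc s ∸ i ∸ suc j} {A + s * D₁}
                                   (third-barycentric (suc s)) (value≡-third g∣m s D₂≡D₁)
      g∣D₁ : g ∣ D₁
      g∣D₁ = ∣m+n∣m⇒∣n (∣[g∸1]*x+x D₁) g∣[g∸1]*D₁
      g∣D₂ : g ∣ D₂
      g∣D₂ = ≡0-mod⇒∣ {g} (trans D₂≡D₁ (∣⇒≡0-mod g∣D₁))

coprime⇒inverse-mod : ∀ {D m} .{{_ : NonZero m}} → Coprime D m → ∃ λ u → D * u ≡ 1 modulo m
coprime⇒inverse-mod {D} {m} D⊥m with coprime-Bézout D⊥m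
... | Bézout.+- x y 1+ym≡xD = x , (begin
  (D * x) % m      ≡⟨ %-congˡ (trans (*-comm D x) (sym 1+ym≡xD)) ⟩
  (1 + y * m) % m  ≡⟨ [m+kn]%n≡m%n 1 y m ⟩
  1 % m            ∎)
  where open ≡-Reasoning
-- Here x D ≡ − 1, and pred m * x represents − x modulo m.
... | Bézout.-+ x y 1+xD≡ym = u , (begin
  (D * u) % m                     ≡⟨ [m+kn]%n≡m%n (D * u) y m ⟨
  (D * u + y * m) % m             ≡⟨ %-congˡ (cong (D * u +_) 1+xD≡ym) ⟨
  (D * u + (1 + x * D)) % m       ≡⟨ %-congˡ (solve 3 (λ D n x → D :* (n :* x) :+ (con 1 :+ x :* D)
                                                           := con 1 :+ x :* D :* (con 1 :+ n))
                                                     refl D (pred m) x) ⟩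
  (1 + x * D * suc (pred m)) % m  ≡⟨ %-congˡ (cong (λ n → 1 + x * D * n) (suc-pred m)) ⟩
  (1 + x * D * m) % m             ≡⟨ [m+kn]%n≡m%n 1 (x * D) m ⟩
  1 % m                           ∎)
  where
  open ≡-Reasoning
  open +-*-Solver
  u : ℕ
  u = pred m * x

coprime⇒invertible : ∀ {m} .{{_ : NonZero m}} (d : ZMod m) → Coprime (toℕ d) m → Invertible d
coprime⇒invertible {m} d d⊥m with coprime⇒inverse-mod d⊥m
... | u , du≡1 = u mod m , toℕ-injective (begin
  toℕ (d *ₘ (u mod m))         ≡⟨ toℕ-fromℕ< _ ⟩
  (toℕ d * toℕ (u mod m)) % m  ≡⟨ *-cong-mod {x = toℕ d} refl (toℕ-mod ∣-refl u) ⟩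
  (toℕ d * u) % m              ≡⟨ du≡1 ⟩
  1 % m                        ≡⟨ toℕ-fromℕ< _ ⟨
  toℕ oneₘ                     ∎)
  where open ≡-Reasoning

theorem3p4 : (m s : ℕ) .{{_ : NonZero m}} → NonZero s →
    (a d₁ d₂ : ZMod m) →
    Balanced (AS a (d₁ , d₂) s) →
    Invertible d₁ × Invertible d₂ × Invertible (d₂ -ₘ d₁)
theorem3p4 m (suc s) _ a d₁ d₂ bal =
    coprime⇒invertible d₁ (d₁-coprime {s} bal)
  , coprime⇒invertible d₂ (d₂-coprime {s} bal)
  , coprime⇒invertible (d₂ -ₘ d₁) (d₂-d₁-coprime {s} bal)
  where open Triangle a d₁ d₂
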